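{- Let $G=(V,E)$ be an argumentation framework, and let $(S_1,C_1),\dots,(S_c,C_c)$ be pairs with $S_j\subseteq V$ and $C_j$ a set containing only maximal admissible subsets of $S_j$. Suppose $T\in C_i$ and $T\subsetneq U$ for some $U\in\bigcup_{j=1}^cC_j$. Then $T$ is the unique maximal admissible subset of $U\cap S_i$.
   Context: An argumentation framework is a finite digraph $G=(V,E)$; an arc $(u,v)$ means $u$ attacks $v$. A set $T\subseteq V$ is conflict-free if no arc has both endpoints in $T$; a vertex $v$ is acceptable with respect to $T$ if for every arc $(u,v)\in E$ there is an arc $(w,u)\in E$ with $w\in T$; $T$ is admissible if it is conflict-free and each of its vertices is acceptable with respect to $T$. For $S\subseteq V$, a maximal admissible subset of $S$ is an admissible $T\subseteq S$ such that no admissible $W$ satisfies $T\subsetneq W\subseteq S$. -}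

module Defs where

open import Data.Nat using (ℕ)
open import Data.Fin using (Fin)
open import Data.Fin.Subset using (Subset; _∈_; _∉_; _⊆_; _⊂_)
open import Data.Product using (∃-syntax; _×_)
open import Relation.Nullary using (¬_)

-- An argumentation framework: a finite digraph on vertex set Fin n.
-- Attacks u v  means the arc (u , v), i.e. u attacks v.
record AF : Set₁ where
  field
    n       : ℕ
    Attacks : Fin n → Fin n → Set

module _ (G : AF) where
  open AF G

  ConflictFree : Subset n → Set
  ConflictFree T = ∀ u v → Attacks u v → u ∈ T → v ∉ T

  Acceptable : Fin n → Subset n → Set
  Acceptable v T = ∀ u → Attacks u v → ∃[ w ] (w ∈ T × Attacks w u)

  Admissible : Subset n → Set
  Admissible T = ConflictFree T × (∀ v → v ∈ T → Acceptable v T)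

  MaxAdmissibleIn : Subset n → Subset n → Set
  MaxAdmissibleIn S T =
    Admissible T × T ⊆ S × (∀ W → Admissible W → T ⊂ W → ¬ (W ⊆ S))

-- Any admissible W ⊆ U ∩ Sᵢ lies, together with T, inside the admissible, hence
-- conflict-free, set U; so W ∪ T is admissible and contained in Sᵢ, and the
-- maximality of T in Sᵢ forces W ⊆ T. Thus T absorbs every admissible subset of
-- U ∩ Sᵢ, which makes it the only maximal one.
module Submission where

open import Defs
open import Data.Nat using (ℕ)
open import Data.Fin using (Fin)
open import Data.Fin.Subset using (Subset; _∈_; _⊆_; _⊂_; _∩_; _∪_)
open import Data.Fin.Subset.Properties
  using (_∈?_; ⊆-trans; ⊆-antisym; p∩q⊆p; p∩q⊆q; x∈p∩q⁺; p⊆p∪q; q⊆p∪q; x∈p∪q⁻)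
open import Data.List.Membership.Propositional using () renaming (_∈_ to _∈ₗ_)
open import Data.List using (List)
open import Data.Product using (∃-syntax; _×_; _,_; proj₁)
open import Data.Sum using ([_,_]′; inj₁; inj₂)
open import Data.Empty using (⊥-elim)
open import Relation.Nullary using (yes; no)
open import Relation.Binary.PropositionalEquality using (_≡_)

module _ {n : ℕ} where

  ∪-least : {p q r : Subset n} → p ⊆ r → q ⊆ r → p ∪ q ⊆ r
  ∪-least {p} {q} p⊆r q⊆r x∈p∪q = [ p⊆r , q⊆r ]′ (x∈p∪q⁻ p q x∈p∪q)

  ⊆-∩ : {p q r : Subset n} → r ⊆ p → r ⊆ q → r ⊆ p ∩ q
  ⊆-∩ r⊆p r⊆q x∈r = x∈p∩q⁺ (r⊆p x∈r , r⊆q x∈r)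

module _ (G : AF) where
  open AF G

  conflictFree-⊆ : {T U : Subset n} → T ⊆ U → ConflictFree G U → ConflictFree G T
  conflictFree-⊆ T⊆U cfU u v uv u∈T v∈T = cfU u v uv (T⊆U u∈T) (T⊆U v∈T)

  admissible-∪ : {W T : Subset n} → ConflictFree G (W ∪ T) →
                 Admissible G W → Admissible G T → Admissible G (W ∪ T)
  admissible-∪ {W} {T} cf (_ , accW) (_ , accT) = cf , acc
    where
    defended : ∀ {v} {R} → R ⊆ W ∪ T → Acceptable G v R → Acceptable G v (W ∪ T)
    defended R⊆ accR u uv with accR u uv
    ... | w , w∈R , wu = w , R⊆ w∈R , wu

    acc : ∀ v → v ∈ W ∪ T → Acceptable G v (W ∪ T)
    acc v v∈ with x∈p∪q⁻ W T v∈
    ... | inj₁ v∈W = defended (p⊆p∪q T) (accW v v∈W)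
    ... | inj₂ v∈T = defended (q⊆p∪q W T) (accT v v∈T)

  maxAdmissibleIn-absorbs : {S T V : Subset n} → MaxAdmissibleIn G S T →
                            Admissible G V → V ⊆ S → T ⊆ V → V ⊆ T
  maxAdmissibleIn-absorbs {T = T} (_ , _ , maximal) admV V⊆S T⊆V {x} x∈V with x ∈? T
  ... | yes x∈T = x∈T
  ... | no  x∉T = ⊥-elim (maximal _ admV (T⊆V , x , x∈V , x∉T) V⊆S)

  maxAdmissibleIn-restrict : {S S′ T : Subset n} → MaxAdmissibleIn G S T →
                             T ⊆ S′ → S′ ⊆ S → MaxAdmissibleIn G S′ T
  maxAdmissibleIn-restrict (admT , _ , maximal) T⊆S′ S′⊆S =
    admT , T⊆S′ , λ W admW T⊂W W⊆S′ → maximal W admW T⊂W (⊆-trans W⊆S′ S′⊆S)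

  admissible-⊆-maxAdmissibleIn : {S T U W : Subset n} → MaxAdmissibleIn G S T →
    Admissible G U → T ⊆ U → Admissible G W → W ⊆ U ∩ S → W ⊆ T
  admissible-⊆-maxAdmissibleIn {S} {T} {U} {W} maxT@(admT , T⊆S , _) (cfU , _) T⊆U admW W⊆U∩S =
    ⊆-trans (p⊆p∪q T) (maxAdmissibleIn-absorbs maxT admW∪T W∪T⊆S (q⊆p∪q _ T))
    where
    admW∪T : Admissible G (W ∪ T)
    admW∪T = admissible-∪ (conflictFree-⊆ (∪-least (⊆-trans W⊆U∩S (p∩q⊆p U S)) T⊆U) cfU)
                          admW admT
    W∪T⊆S : W ∪ T ⊆ S
    W∪T⊆S = ∪-least (⊆-trans W⊆U∩S (p∩q⊆q U S)) T⊆S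

  unique-maxAdmissibleIn : {S T U : Subset n} → MaxAdmissibleIn G S T →
    Admissible G U → T ⊆ U →
    MaxAdmissibleIn G (U ∩ S) T × (∀ W → MaxAdmissibleIn G (U ∩ S) W → W ≡ T)
  unique-maxAdmissibleIn {S} {T} {U} maxT@(admT , T⊆S , _) admU T⊆U = maxT′ , unique
    where
    T⊆U∩S : T ⊆ U ∩ S
    T⊆U∩S = ⊆-∩ T⊆U T⊆S

    maxT′ : MaxAdmissibleIn G (U ∩ S) T
    maxT′ = maxAdmissibleIn-restrict maxT T⊆U∩S (p∩q⊆q U S)

    unique : ∀ W → MaxAdmissibleIn G (U ∩ S) W → W ≡ T
    unique W maxW@(admW , W⊆U∩S , _) =
      ⊆-antisym W⊆T (maxAdmissibleIn-absorbs maxW admT T⊆U∩S W⊆T)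
      where
      W⊆T : W ⊆ T
      W⊆T = admissible-⊆-maxAdmissibleIn maxT admU T⊆U admW W⊆U∩S

mainTheorem12 : (G : AF) (c : ℕ)
    (S : Fin c → Subset (AF.n G)) (C : Fin c → List (Subset (AF.n G)))
    → (∀ j T → T ∈ₗ C j → MaxAdmissibleIn G (S j) T)
    → (i : Fin c) (T : Subset (AF.n G)) → T ∈ₗ C i
    → (U : Subset (AF.n G)) → (∃[ j ] U ∈ₗ C j) → T ⊂ U
    → MaxAdmissibleIn G (U ∩ S i) T
      × (∀ W → MaxAdmissibleIn G (U ∩ S i) W → W ≡ T)
mainTheorem12 G c S C maximal i T T∈Cᵢ U (j , U∈Cⱼ) (T⊆U , _) =
  unique-maxAdmissibleIn G (maximal i T T∈Cᵢ) (proj₁ (maximal j U U∈Cⱼ)) T⊆U
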